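{- Let $S[1:n]$ be a sequence of distinct real numbers, $k\ge 3$ and $1\le i\le n$. Let $A$ be a subsequence of $S[1:i]$ that is a $k$-rollercoaster whose last run is decreasing, and let $r$ be an increasing subsequence of $S[i:n]$ with $|r|\geq k$. Then there exists a subsequence of $S[1:n]$ that is a $k$-rollercoaster whose last run is increasing and whose length is at least $|A|+|r|-1$.
   Context: $S[a:b]$ denotes the contiguous subsequence $(S[a],\dots,S[b])$. A subsequence is obtained by choosing indices $i_1<\dots<i_m$ (not necessarily contiguous). A run of a sequence is a maximal contiguous subsequence that is increasing or decreasing; a $k$-rollercoaster is a sequence every run of which has length at least $k$. -}

module Defs where

open import Level using (Level)
open import Data.Nat using (ℕ; suc; _≤_; _∸_) renaming (_<_ to _<ℕ_)
open import Data.Product using (_×_; ∃)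
open import Data.Sum using (_⊎_)
open import Relation.Binary using (Rel)
open import Relation.Binary.PropositionalEquality using (_≡_)

-- A finite sequence of length m is a function w : ℕ → A, of which only the
-- entries w 0 , … , w (m ∸ 1) matter (0-based positions).

module _ {a ℓ : Level} {A : Set a} (_<_ : Rel A ℓ) where

  Inc : (ℕ → A) → ℕ → ℕ → Set ℓ
  Inc w p q = ∀ j → p ≤ j → j <ℕ q → w j < w (suc j)

  Decr : (ℕ → A) → ℕ → ℕ → Set ℓ
  Decr w p q = ∀ j → p ≤ j → j <ℕ q → w (suc j) < w j

  Mono : (ℕ → A) → ℕ → ℕ → Set ℓ
  Mono w p q = Inc w p q ⊎ Decr w p q

  IsRun : ℕ → (ℕ → A) → ℕ → ℕ → Set ℓ
  IsRun m w p q =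
    p ≤ q × q <ℕ m × Mono w p q ×
    (∀ p' q' → p' ≤ p → q ≤ q' → q' <ℕ m → Mono w p' q' → p' ≡ p × q' ≡ q)

  Rollercoaster : ℕ → ℕ → (ℕ → A) → Set ℓ
  Rollercoaster k m w = ∀ p q → IsRun m w p q → k ≤ suc (q ∸ p)

  LastRunDecr : ℕ → (ℕ → A) → Set ℓ
  LastRunDecr m w = ∃ λ p → IsRun m w p (m ∸ 1) × Decr w p (m ∸ 1)

  LastRunInc : ℕ → (ℕ → A) → Set ℓ
  LastRunInc m w = ∃ λ p → IsRun m w p (m ∸ 1) × Inc w p (m ∸ 1)

-- f describes a subsequence of length m of S[lo:hi]: f 0 < f 1 < … < f (m ∸ 1)
-- are the chosen (1-based) indices, all in [lo, hi]; the subsequence is S ∘ f.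
IsSubseqIdx : ℕ → ℕ → ℕ → (ℕ → ℕ) → Set
IsSubseqIdx lo hi m f =
  (∀ j → j <ℕ m → lo ≤ f j × f j ≤ hi) × (∀ j → suc j <ℕ m → f j <ℕ f (suc j))

-- Glue A and r where A's final decreasing run meets r, so that the junction becomes a valley:
-- A's last run descends into it (absorbing the first element of r if that is smaller) and r
-- ascends out of it (preceded by the last element of A if that is smaller, or sharing it when
-- both are the entry S i).  A run ending before the valley is already a run of A, the run into
-- the valley is at least as long as A's last run, and the run out of it contains all of r;
-- so the glued sequence is a k-rollercoaster ending in an increasing run, and it loses at most
-- one element of A and r.
module Submission where

open import Defs
open import Level using (Level)
open import Function using (_∘_)
open import Data.Nat using (ℕ; zero; suc; z≤n; s≤s; _≤_; _+_; _∸_) renaming (_<_ to _<ℕ_)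
open import Data.Nat.Properties
open import Data.Product using (_×_; ∃; _,_; proj₁; proj₂)
open import Data.Sum using (_⊎_; inj₁; inj₂)
open import Data.Empty using (⊥-elim)
open import Relation.Nullary using (¬_; Dec; yes; no; contradiction)
open import Relation.Binary using (Rel; StrictTotalOrder; tri<; tri≈; tri>)
open import Relation.Binary.Definitions using (Asymmetric)
open import Relation.Binary.PropositionalEquality using (_≡_; refl; sym; trans; cong; subst; subst₂)

n≤m<n+o⇒m∸n<o : ∀ {m n o} → n ≤ m → m <ℕ n + o → m ∸ n <ℕ o
n≤m<n+o⇒m∸n<o {m} {n} {o} n≤m m<n+o = subst (m ∸ n <ℕ_) (m+n∸m≡n n o) (∸-monoˡ-< m<n+o n≤m)

run-length≥2⇒< : ∀ {k p q} → 2 ≤ k → k ≤ suc (q ∸ p) → p <ℕ q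
run-length≥2⇒< 2≤k k≤len = m∸n≢0⇒n<m λ empty →
  contradiction (subst (λ d → 2 ≤ suc d) empty (≤-trans 2≤k k≤len)) λ { (s≤s ()) }

splice : ∀ {a} {A : Set a} → ℕ → (ℕ → A) → (ℕ → A) → ℕ → A
splice zero    u w j       = w j
splice (suc t) u w zero    = u zero
splice (suc t) u w (suc j) = splice t (u ∘ suc) w j

splice-< : ∀ {a} {A : Set a} t (u w : ℕ → A) {j} → j <ℕ t → splice t u w j ≡ u j
splice-< (suc t) u w {zero}  _         = refl
splice-< (suc t) u w {suc j} (s≤s j<t) = splice-< t (u ∘ suc) w j<t

splice-≥ : ∀ {a} {A : Set a} t (u w : ℕ → A) {j} → t ≤ j → splice t u w j ≡ w (j ∸ t)
splice-≥ zero    u w         _         = refl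
splice-≥ (suc t) u w {suc j} (s≤s t≤j) = splice-≥ t (u ∘ suc) w t≤j

splice-at : ∀ {a} {A : Set a} t (u w : ℕ → A) → splice t u w t ≡ w 0
splice-at t u w = trans (splice-≥ t u w ≤-refl) (cong w (n∸n≡0 t))

IsSubseqIdx-prefix : ∀ {lo hi m t f} → t ≤ m → IsSubseqIdx lo hi m f → IsSubseqIdx lo hi t f
IsSubseqIdx-prefix t≤m (bounded , increasing) =
  (λ j j<t → bounded j (<-≤-trans j<t t≤m)) , (λ j j<t → increasing j (<-≤-trans j<t t≤m))

IsSubseqIdx-splice : ∀ {lo mid hi t m fa fb} → lo ≤ mid → mid ≤ hi →
  IsSubseqIdx lo mid (suc t) fa → IsSubseqIdx mid hi (suc m) fb → fa t <ℕ fb 0 →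
  IsSubseqIdx lo hi (suc (suc t + m)) (splice (suc t) fa fb)
IsSubseqIdx-splice {lo} {mid} {hi} {t} {m} {fa} {fb} lo≤mid mid≤hi (boundedA , increasingA) (boundedB , increasingB) junction =
  bounded , increasing
  where
  f : ℕ → ℕ
  f = splice (suc t) fa fb

  bounded : ∀ j → j <ℕ suc (suc t + m) → lo ≤ f j × f j ≤ hi
  bounded j j<len with j <? suc t
  ... | yes j<t = subst (λ x → lo ≤ x × x ≤ hi) (sym (splice-< (suc t) fa fb j<t))
                    (proj₁ (boundedA j j<t) , ≤-trans (proj₂ (boundedA j j<t)) mid≤hi)
  ... | no j≮t  = subst (λ x → lo ≤ x × x ≤ hi) (sym (splice-≥ (suc t) fa fb t≤j))
                    (≤-trans lo≤mid (proj₁ inB) , proj₂ inB)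
    where
    t≤j : suc t ≤ j
    t≤j = ≮⇒≥ j≮t
    inB : mid ≤ fb (j ∸ suc t) × fb (j ∸ suc t) ≤ hi
    inB = boundedB (j ∸ suc t) (n≤m<n+o⇒m∸n<o t≤j (subst (j <ℕ_) (sym (+-suc (suc t) m)) j<len))

  increasing : ∀ j → suc j <ℕ suc (suc t + m) → f j <ℕ f (suc j)
  increasing j sj<len with <-cmp (suc j) (suc t)
  ... | tri< sj<t _ _ = subst₂ _<ℕ_ (sym (splice-< (suc t) fa fb (<-trans (n<1+n j) sj<t)))
                          (sym (splice-< (suc t) fa fb sj<t)) (increasingA j sj<t)
  ... | tri≈ _ refl _ = subst₂ _<ℕ_ (sym (splice-< (suc t) fa fb ≤-refl))
                          (sym (splice-at (suc t) fa fb)) junction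
  ... | tri> _ _ t<sj = subst₂ _<ℕ_ (sym (splice-≥ (suc t) fa fb t≤j))
                          (sym (trans (splice-≥ (suc t) fa fb (m≤n⇒m≤1+n t≤j)) (cong fb (+-∸-assoc 1 t≤j))))
                          (increasingB (j ∸ suc t) (s≤s (n≤m<n+o⇒m∸n<o t≤j (≤-pred sj<len))))
    where
    t≤j : suc t ≤ j
    t≤j = ≤-pred t<sj

Agree : ∀ {a} {A : Set a} → ℕ → (ℕ → A) → (ℕ → A) → Set a
Agree L w w' = ∀ j → j <ℕ L → w j ≡ w' j

Agree-sym : ∀ {a} {A : Set a} {L} {w w' : ℕ → A} → Agree L w w' → Agree L w' w
Agree-sym agree j j<L = sym (agree j j<L)

module Runs {a ℓ} {A : Set a} (_<_ : Rel A ℓ) where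

  Inc-agree : ∀ {L p q w w'} → Agree L w w' → q <ℕ L → Inc _<_ w p q → Inc _<_ w' p q
  Inc-agree agree q<L inc j p≤j j<q =
    subst₂ _<_ (agree j (<-trans j<q q<L)) (agree (suc j) (≤-<-trans j<q q<L)) (inc j p≤j j<q)

  Decr-agree : ∀ {L p q w w'} → Agree L w w' → q <ℕ L → Decr _<_ w p q → Decr _<_ w' p q
  Decr-agree agree q<L dec j p≤j j<q =
    subst₂ _<_ (agree (suc j) (≤-<-trans j<q q<L)) (agree j (<-trans j<q q<L)) (dec j p≤j j<q)

  Mono-agree : ∀ {L p q w w'} → Agree L w w' → q <ℕ L → Mono _<_ w p q → Mono _<_ w' p q
  Mono-agree agree q<L (inj₁ inc) = inj₁ (Inc-agree agree q<L inc)
  Mono-agree agree q<L (inj₂ dec) = inj₂ (Decr-agree agree q<L dec)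

  -- Restricting can only make a run easier to be maximal: there are fewer competitors.
  IsRun-restrict : ∀ {L m p q w w'} → Agree L w w' → L ≤ m → q <ℕ L →
                   IsRun _<_ m w p q → IsRun _<_ L w' p q
  IsRun-restrict agree L≤m q<L (p≤q , _ , mono , maximal) =
    p≤q , q<L , Mono-agree agree q<L mono ,
    λ p' q' p'≤p q≤q' q'<L mono' →
      maximal p' q' p'≤p q≤q' (<-≤-trans q'<L L≤m) (Mono-agree (Agree-sym agree) q'<L mono')

  Inc-shift : ∀ {t m w w'} → (∀ j → t ≤ j → w' j ≡ w (j ∸ t)) → Inc _<_ w 0 m → Inc _<_ w' t (t + m)
  Inc-shift {t} {m} {w} shift inc j t≤j j<t+m =
    subst₂ _<_ (sym (shift j t≤j))
      (sym (trans (shift (suc j) (m≤n⇒m≤1+n t≤j)) (cong w (+-∸-assoc 1 t≤j))))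
      (inc (j ∸ t) z≤n (n≤m<n+o⇒m∸n<o t≤j j<t+m))

  Inc-cons : ∀ {p q w} → w p < w (suc p) → Inc _<_ w (suc p) q → Inc _<_ w p q
  Inc-cons step inc j p≤j j<q with m≤n⇒m<n∨m≡n p≤j
  ... | inj₁ p<j = inc j p<j j<q
  ... | inj₂ refl = step

  Decr-snoc : ∀ {p q w} → Decr _<_ w p q → w (suc q) < w q → Decr _<_ w p (suc q)
  Decr-snoc dec step j p≤j j<sq with m≤n⇒m<n∨m≡n (≤-pred j<sq)
  ... | inj₁ j<q = dec j p≤j j<q
  ... | inj₂ refl = step

  module _ (asym : Asymmetric _<_) where

    ¬Mono-through-valley : ∀ {w c p q} → w (suc c) < w c → w (suc c) < w (suc (suc c)) →
                           p ≤ c → suc c <ℕ q → ¬ Mono _<_ w p q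
    ¬Mono-through-valley {c = c} down _  p≤c c<q (inj₁ inc) = asym down (inc c p≤c (<-trans (n<1+n c) c<q))
    ¬Mono-through-valley         _    up p≤c c<q (inj₂ dec) = asym up (dec _ (m≤n⇒m≤1+n p≤c) c<q)

    module ValleyJoin {L M p c} {w wA : ℕ → A} (agree : Agree L w wA) (v≤L : suc c ≤ L) (L≤m : L ≤ suc M)
                      (p≤c : p ≤ c) (dec : Decr _<_ w p (suc c)) (inc : Inc _<_ w (suc c) M) where

      run-cases : ∀ {p' q'} → IsRun _<_ (suc M) w p' q' →
                  IsRun _<_ L wA p' q' ⊎ (p' ≤ p × q' ≡ suc c) ⊎ (p' ≡ suc c × q' ≡ M)
      run-cases {p'} {q'} run@(_ , q'<m , mono , maximal) with <-cmp q' (suc c)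
      ... | tri< q'<v _ _ = inj₁ (IsRun-restrict agree L≤m (<-≤-trans q'<v v≤L) run)
      ... | tri≈ _ refl _ = inj₂ (inj₁ (starts-before , refl))
        where
        starts-before : p' ≤ p
        starts-before with ≤-total p p'
        ... | inj₁ p≤p' = ≤-reflexive (sym (proj₁ (maximal p (suc c) p≤p' ≤-refl q'<m (inj₂ dec))))
        ... | inj₂ p'≤p = p'≤p
      ... | tri> _ _ v<q' with suc c ≤? p'
      ...   | yes v≤p' = inj₂ (inj₂ (sym (proj₁ ends) , sym (proj₂ ends)))
        where
        ends : suc c ≡ p' × M ≡ q'
        ends = maximal (suc c) M v≤p' (<⇒≤pred q'<m) ≤-refl (inj₁ inc)
      ...   | no v≰p' = ⊥-elim (¬Mono-through-valley (dec c p≤c ≤-refl)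
                          (inc (suc c) ≤-refl (<-≤-trans v<q' (<⇒≤pred q'<m))) (≤-pred (≰⇒> v≰p')) v<q' mono)

      increasing-run : suc c <ℕ M → IsRun _<_ (suc M) w (suc c) M
      increasing-run v<M = <⇒≤ v<M , ≤-refl , inj₁ inc , maximal
        where
        maximal : ∀ p' q' → p' ≤ suc c → M ≤ q' → q' <ℕ suc M → Mono _<_ w p' q' → p' ≡ suc c × q' ≡ M
        maximal p' q' p'≤v M≤q' q'<m mono with suc c ≤? p'
        ... | yes v≤p' = ≤-antisym p'≤v v≤p' , ≤-antisym (<⇒≤pred q'<m) M≤q'
        ... | no v≰p' = ⊥-elim (¬Mono-through-valley (dec c p≤c ≤-refl) (inc (suc c) ≤-refl v<M)
                          (≤-pred (≰⇒> v≰p')) (<-≤-trans v<M M≤q') mono)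

    valley-join : ∀ {k L M p v} {w wA : ℕ → A} → 2 ≤ k → Rollercoaster _<_ k L wA → Agree L w wA →
                  v ≤ L → L ≤ suc M → Decr _<_ w p v → Inc _<_ w v M →
                  k ≤ suc (v ∸ p) → k ≤ suc (M ∸ v) →
                  Rollercoaster _<_ k (suc M) w × LastRunInc _<_ (suc M) w
    valley-join {k} {M = M} {p} {v} {w} 2≤k rcA agree v≤L L≤m dec inc k≤dec k≤inc
      with run-length≥2⇒< {p = p} {v} 2≤k k≤dec | run-length≥2⇒< {p = v} {M} 2≤k k≤inc
    ... | s≤s p≤c | v<M = rollercoaster , (_ , increasing-run v<M , inc)
      where
      open ValleyJoin agree v≤L L≤m p≤c dec inc

      rollercoaster : Rollercoaster _<_ k (suc M) w
      rollercoaster p' q' run with run-cases run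
      ... | inj₁ runA                    = rcA p' q' runA
      ... | inj₂ (inj₁ (p'≤p , refl))    = ≤-trans k≤dec (s≤s (∸-monoʳ-≤ _ p'≤p))
      ... | inj₂ (inj₂ (refl , refl))    = k≤inc

module Gluing {c ℓ₁ ℓ₂} (O : StrictTotalOrder c ℓ₁ ℓ₂) (S : ℕ → StrictTotalOrder.Carrier O)
  {n k i : ℕ} (2≤k : 2 ≤ k) (1≤i : 1 ≤ i) (i≤n : i ≤ n)
  {b pA : ℕ} {fA : ℕ → ℕ} (sA : IsSubseqIdx 1 i (suc (suc b)) fA)
  (rcA : Rollercoaster (StrictTotalOrder._<_ O) k (suc (suc b)) (S ∘ fA))
  (decA : Decr (StrictTotalOrder._<_ O) (S ∘ fA) pA (suc b)) (k≤decA : k ≤ suc (suc b ∸ pA))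
  {m' : ℕ} {fr : ℕ → ℕ} (sr : IsSubseqIdx i n (suc m') fr)
  (incR : Inc (StrictTotalOrder._<_ O) (S ∘ fr) 0 m') (k≤mr : k ≤ suc m')
  where

  open StrictTotalOrder O using (_<_; asym)
  open Runs _<_

  a : ℕ
  a = suc b

  Glued : Set ℓ₂
  Glued = ∃ λ m → ∃ λ f → IsSubseqIdx 1 n m f ×
    Rollercoaster _<_ k m (S ∘ f) × LastRunInc _<_ m (S ∘ f) × suc a + suc m' ∸ 1 ≤ m

  glued : ∀ {m f} → IsSubseqIdx 1 n m f → Rollercoaster _<_ k m (S ∘ f) × LastRunInc _<_ m (S ∘ f) →
          suc a + suc m' ∸ 1 ≤ m → Glued
  glued subseq (rc , lastRunInc) bound = _ , _ , subseq , rc , lastRunInc , bound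

  agree-prefix : ∀ t → Agree t (S ∘ splice t fA fr) (S ∘ fA)
  agree-prefix t j j<t = cong S (splice-< t fA fr j<t)

  inc-tail : ∀ t → Inc _<_ (S ∘ splice t fA fr) t (t + m')
  inc-tail t = Inc-shift (λ j t≤j → cong S (splice-≥ t fA fr t≤j)) incR

  S-at-junction : S (splice (suc a) fA fr (suc a)) ≡ S (fr 0)
  S-at-junction = cong S (splice-at (suc a) fA fr)

  k≤incRun : ∀ v {M} → v + m' ≤ M → k ≤ suc (M ∸ v)
  k≤incRun v {M} v+m'≤M = ≤-trans k≤mr (s≤s (m+n≤o⇒m≤o∸n m' (subst (_≤ M) (+-comm v m') v+m'≤M)))

  glue-at-shared-index : fA a ≡ fr 0 → Glued
  glue-at-shared-index shared =
    glued subseq (valley-join asym 2≤k rcA agree (n≤1+n a) (s≤s (m≤m+n a m'))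
      (Decr-agree (Agree-sym agree) ≤-refl decA) (inc-tail a) k≤decA (k≤incRun a ≤-refl))
      (≤-reflexive (+-suc a m'))
    where
    f : ℕ → ℕ
    f = splice a fA fr

    subseq : IsSubseqIdx 1 n (suc (a + m')) f
    subseq = IsSubseqIdx-splice 1≤i i≤n (IsSubseqIdx-prefix (n≤1+n a) sA) sr
               (subst (fA b <ℕ_) shared (proj₂ sA b ≤-refl))

    agree : Agree (suc a) (S ∘ f) (S ∘ fA)
    agree j j<sa with m≤n⇒m<n∨m≡n (≤-pred j<sa)
    ... | inj₁ j<a = agree-prefix a j j<a
    ... | inj₂ refl = cong S (trans (splice-at a fA fr) (sym shared))

  module _ (separated : fA a <ℕ fr 0) where

    f : ℕ → ℕ
    f = splice (suc a) fA fr

    subseq : IsSubseqIdx 1 n (suc (suc a + m')) f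
    subseq = IsSubseqIdx-splice 1≤i i≤n sA sr separated

    decA′ : Decr _<_ (S ∘ f) pA a
    decA′ = Decr-agree (Agree-sym (agree-prefix (suc a))) ≤-refl decA

    prefix≤length : suc a ≤ suc (suc a + m')
    prefix≤length = s≤s (≤-trans (n≤1+n a) (m≤m+n (suc a) m'))

    bound : suc a + suc m' ∸ 1 ≤ suc (suc a + m')
    bound = ≤-trans (≤-reflexive (+-suc a m')) (n≤1+n _)

    glue-ascending : S (fA a) < S (fr 0) → Glued
    glue-ascending up =
      glued subseq (valley-join asym 2≤k rcA (agree-prefix (suc a)) (n≤1+n a) prefix≤length decA′
        (Inc-cons (subst₂ _<_ (sym (agree-prefix (suc a) a ≤-refl)) (sym S-at-junction) up) (inc-tail (suc a)))
        k≤decA (k≤incRun a (n≤1+n _))) bound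

    glue-descending : S (fr 0) < S (fA a) → Glued
    glue-descending down =
      glued subseq (valley-join asym 2≤k rcA (agree-prefix (suc a)) ≤-refl prefix≤length
        (Decr-snoc decA′ (subst₂ _<_ (sym S-at-junction) (sym (agree-prefix (suc a) a ≤-refl)) down))
        (inc-tail (suc a)) (≤-trans k≤decA (s≤s (∸-monoˡ-≤ pA (n≤1+n a)))) (k≤incRun (suc a) ≤-refl)) bound

lemma15 : {c ℓ₁ ℓ₂ : Level} (O : StrictTotalOrder c ℓ₁ ℓ₂) →
    (n k i : ℕ) (S : ℕ → StrictTotalOrder.Carrier O) →
    (∀ a b → 1 ≤ a → a ≤ n → 1 ≤ b → b ≤ n → ¬ a ≡ b → ¬ StrictTotalOrder._≈_ O (S a) (S b)) →
    3 ≤ k → 1 ≤ i → i ≤ n →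
    (mA : ℕ) (fA : ℕ → ℕ) → IsSubseqIdx 1 i mA fA →
    Rollercoaster (StrictTotalOrder._<_ O) k mA (S ∘ fA) → LastRunDecr (StrictTotalOrder._<_ O) mA (S ∘ fA) →
    (mr : ℕ) (fr : ℕ → ℕ) → IsSubseqIdx i n mr fr →
    Inc (StrictTotalOrder._<_ O) (S ∘ fr) 0 (mr ∸ 1) → k ≤ mr →
    ∃ λ m → ∃ λ f → IsSubseqIdx 1 n m f ×
    Rollercoaster (StrictTotalOrder._<_ O) k m (S ∘ f) × LastRunInc (StrictTotalOrder._<_ O) m (S ∘ f) ×
    mA + mr ∸ 1 ≤ m
lemma15 _ _ _ _ _ _ _ _ _ zero _ _ _ (_ , (_ , () , _) , _) _ _ _ _ _
lemma15 _ _ _ _ _ _ 3≤k _ _ (suc _) _ _ _ _ zero _ _ _ k≤mr =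
  contradiction (≤-trans 3≤k k≤mr) λ ()
lemma15 _ _ _ _ _ _ 3≤k _ _ (suc zero) _ _ rcA (pA , runA , _) _ _ _ _ _ =
  contradiction (≤-trans 3≤k (≤-trans (rcA pA 0 runA) (s≤s (m∸n≤m 0 pA)))) λ { (s≤s ()) }
lemma15 O n k i S distinct 3≤k 1≤i i≤n (suc (suc b)) fA sA rcA (pA , runA , decA) (suc m') fr sr incR k≤mr =
  glue (fA (suc b) ≟ fr 0)
  where
  open Gluing O S (≤-trans (n≤1+n 2) 3≤k) 1≤i i≤n sA rcA decA (rcA pA (suc b) runA) sr incR k≤mr
  lastA : 1 ≤ fA (suc b) × fA (suc b) ≤ i
  lastA = proj₁ sA (suc b) ≤-refl
  firstR : i ≤ fr 0 × fr 0 ≤ n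
  firstR = proj₁ sr 0 (s≤s z≤n)

  separated : ¬ fA (suc b) ≡ fr 0 → fA (suc b) <ℕ fr 0
  separated = ≤∧≢⇒< (≤-trans (proj₂ lastA) (proj₁ firstR))

  glue : Dec (fA (suc b) ≡ fr 0) → Glued
  glue (yes shared) = glue-at-shared-index shared
  glue (no unshared) with StrictTotalOrder.compare O (S (fA (suc b))) (S (fr 0))
  ... | tri< up _ _   = glue-ascending (separated unshared) up
  ... | tri> _ _ down = glue-descending (separated unshared) down
  ... | tri≈ _ same _ = contradiction same
    (distinct _ _ (proj₁ lastA) (≤-trans (proj₂ lastA) i≤n) (≤-trans 1≤i (proj₁ firstR)) (proj₂ firstR) unshared)
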